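{- For all positive integers $n$ and $r$, $$ \sum_{\ell=1}^n q^{\ell-1}[\ell]_q H_\ell^{(r)}(q)=\frac{[n]_q[n+r]_q}{[r+1]_q}H_n^{(r)}(q)-\frac{q^r[n-1]_q[n]_q}{([r+1]_q)^2}\binom{n+r-1}{r-1}_q =\frac{[n]_q[r]_q}{[r+1]_q}H_n^{(r+1)}(q)+\frac{q^{r-1}}{[r+1]_q}\binom{n+r}{r+1}_q\,. $$
   Context: $q$ is a parameter (e.g. an indeterminate, or a nonzero complex number) for which all quantities below are defined. $[n]_q=\frac{1-q^n}{1-q}=1+q+\dots+q^{n-1}$, $[n]_q!=[n]_q[n-1]_q\cdots[1]_q$ with $[0]_q!=1$, and $\binom{n}{k}_q=\frac{[n]_q!}{[k]_q![n-k]_q!}$ for $0\le k\le n$ and $0$ otherwise. The $q$-hyperharmonic numbers are defined by $H_n^{(0)}(q)=\frac{1}{q[n]_q}$ for $n\ge1$ and $H_n^{(r)}(q)=\sum_{j=1}^n q^jH_j^{(r-1)}(q)$ for $r,n\ge1$. -}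

module Defs where

open import Level using (Level; _⊔_) renaming (suc to lsuc)
open import Algebra.Bundles using (CommutativeRing)
open import Data.Nat using (ℕ; zero; suc; _∸_; _≤?_)
open import Relation.Nullary using (¬_; yes; no)

-- A field: a commutative ring with 0 ≠ 1 and a (total) inverse operation
-- that is a two-sided inverse on every nonzero element.
-- (The value of 0⁻¹ is irrelevant: it is never used below under the
-- hypotheses of the theorem.)
record Field (c ℓ : Level) : Set (lsuc (c ⊔ ℓ)) where
  field
    commutativeRing : CommutativeRing c ℓ
  open CommutativeRing commutativeRing public
  field
    _⁻¹      : Carrier → Carrier
    ⁻¹-cong  : ∀ {x y} → x ≈ y → x ⁻¹ ≈ y ⁻¹
    inverseʳ : ∀ x → ¬ (x ≈ 0#) → x * (x ⁻¹) ≈ 1#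
    0≉1      : ¬ (0# ≈ 1#)

module QDefs {c ℓ} (F : Field c ℓ) (q : Field.Carrier F) where
  open Field F

  infixl 7 _/_
  _/_ : Carrier → Carrier → Carrier
  x / y = x * (y ⁻¹)

  qpow : ℕ → Carrier
  qpow zero    = 1#
  qpow (suc n) = q * qpow n

  qint : ℕ → Carrier
  qint zero    = 0#
  qint (suc n) = qint n + qpow n

  qfact : ℕ → Carrier
  qfact zero    = 1#
  qfact (suc n) = qint (suc n) * qfact n

  qbinom : ℕ → ℕ → Carrier
  qbinom n k with k ≤? n
  ... | yes _ = qfact n / (qfact k * qfact (n ∸ k))
  ... | no  _ = 0#

  Σ₁ : ℕ → (ℕ → Carrier) → Carrier
  Σ₁ zero    f = 0#
  Σ₁ (suc n) f = Σ₁ n f + f (suc n)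

  -- q-hyperharmonic numbers H r n = H_n^{(r)}(q)  (only n ≥ 1 is meaningful;
  -- the value at n = 0 for r = 0 is an unused convention)
  H : ℕ → ℕ → Carrier
  H zero    n = (q * qint n) ⁻¹
  H (suc r) n = Σ₁ n (λ j → qpow j * H r j)

-- Write K s m for the q-binomial coefficient binom(m+s, s)_q.  The heart of the proof is the
-- recurrence
--   q [m+1] H_{m+1}^{(s)} = q [s] H_m^{(s+1)} + q^s K s m,
-- proved by a double induction on s and m from the q-Pascal rule.  Together with
-- H_{m+1}^{(s+1)} = H_m^{(s+1)} + q^{m+1} H_{m+1}^{(s)} it rewrites [r] H_n^{(r+1)} in terms of
-- [n+r] H_n^{(r)}, and summed over n it gives
--   [r+1] Σ_{l ≤ n} q^{l-1} [l] H_l^{(r)} = [n] [r] H_n^{(r+1)} + q^{r-1} binom(n+r, r+1)_q.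
-- After multiplication by [r+1]^2 both claimed identities follow from these two relations and
--   [r+1] [n] binom(n+r-1, r)_q = [r+1] binom(n+r, r+1)_q + q [n-1] [n] binom(n+r-1, r-1)_q.
-- The hypotheses q ≠ 0 and [k] ≠ 0 for k ≤ n + r are used only to cancel factors.

module Submission where

open import Defs
open import Data.Nat using (ℕ; _∸_; _≤_) renaming (_+_ to _+ℕ_)
open import Data.Product using (_×_)
open import Relation.Nullary using (¬_)
open import Data.Nat using (zero; suc; _≤?_; z≤n; s≤s)
import Data.Nat.Properties as ℕₚ
open import Data.Product using (_,_)
open import Relation.Nullary using (yes; no; contradiction)
import Relation.Binary.PropositionalEquality as ≡
open ≡ using (_≡_)

module FieldProperties {c ℓ} (F : Field c ℓ) where
  open Field F
  open import Algebra.Properties.Group +-group using (//-rightDividesʳ)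
  open import Algebra.Solver.Ring.NaturalCoefficients.Default commutativeSemiring
  open import Relation.Binary.Reasoning.Setoid setoid

  x≈a⁻¹*[a*x] : ∀ {a} x → ¬ a ≈ 0# → x ≈ a ⁻¹ * (a * x)
  x≈a⁻¹*[a*x] {a} x a≉0 = begin
    x               ≈⟨ *-identityˡ x ⟨
    1# * x          ≈⟨ *-congʳ (inverseʳ a a≉0) ⟨
    a * a ⁻¹ * x    ≈⟨ solve 3 (λ a a⁻¹ x → a :* a⁻¹ :* x := a⁻¹ :* (a :* x)) refl _ _ _ ⟩
    a ⁻¹ * (a * x)  ∎

  *-cancelˡ : ∀ {a x y} → ¬ a ≈ 0# → a * x ≈ a * y → x ≈ y
  *-cancelˡ {a} {x} {y} a≉0 ax≈ay = begin
    x               ≈⟨ x≈a⁻¹*[a*x] x a≉0 ⟩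
    a ⁻¹ * (a * x)  ≈⟨ *-congˡ ax≈ay ⟩
    a ⁻¹ * (a * y)  ≈⟨ x≈a⁻¹*[a*x] y a≉0 ⟨
    y               ∎

  x≉0∧y≉0⇒x*y≉0 : ∀ {x y} → ¬ x ≈ 0# → ¬ y ≈ 0# → ¬ x * y ≈ 0#
  x≉0∧y≉0⇒x*y≉0 {x} x≉0 y≉0 xy≈0 = y≉0 (*-cancelˡ x≉0 (trans xy≈0 (sym (zeroʳ x))))

  a*[x*a⁻¹]≈x : ∀ {a} x → ¬ a ≈ 0# → a * (x * a ⁻¹) ≈ x
  a*[x*a⁻¹]≈x {a} x a≉0 = begin
    a * (x * a ⁻¹)  ≈⟨ solve 3 (λ a x a⁻¹ → a :* (x :* a⁻¹) := x :* (a :* a⁻¹)) refl _ _ _ ⟩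
    x * (a * a ⁻¹)  ≈⟨ *-congˡ (inverseʳ a a≉0) ⟩
    x * 1#          ≈⟨ *-identityʳ x ⟩
    x               ∎

  x≈z+y⇒x-y≈z : ∀ {x y z} → x ≈ z + y → x - y ≈ z
  x≈z+y⇒x-y≈z {y = y} {z} x≈z+y = trans (+-congʳ x≈z+y) (//-rightDividesʳ y z)

  clear-denominators : ∀ {a S P h x y z w Q B} → ¬ a ≈ 0# →
    a * S ≈ x * y + z * w →
    a * (P * h) ≈ a * (x * y + z * w) + Q * B →
    (S ≈ P * a ⁻¹ * h - Q * (a * a) ⁻¹ * B)
      × (P * a ⁻¹ * h - Q * (a * a) ⁻¹ * B ≈ x * a ⁻¹ * y + z * a ⁻¹ * w)
  clear-denominators {a} {S} {P} {h} {x} {y} {z} {w} {Q} {B} a≉0 aS≈ aPh≈ =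
    trans S≈Z (sym X-Y≈Z) , X-Y≈Z
    where
    Z : Carrier
    Z = x * a ⁻¹ * y + z * a ⁻¹ * w

    aZ≈ : a * Z ≈ x * y + z * w
    aZ≈ = begin
      a * Z
        ≈⟨ solve 5 (λ a u y v w → a :* (u :* y :+ v :* w) := a :* u :* y :+ a :* v :* w) refl _ _ _ _ _ ⟩
      a * (x * a ⁻¹) * y + a * (z * a ⁻¹) * w
        ≈⟨ +-cong (*-congʳ (a*[x*a⁻¹]≈x x a≉0)) (*-congʳ (a*[x*a⁻¹]≈x z a≉0)) ⟩
      x * y + z * w
        ∎

    S≈Z : S ≈ Z
    S≈Z = *-cancelˡ a≉0 (trans aS≈ (sym aZ≈))

    X-Y≈Z : P * a ⁻¹ * h - Q * (a * a) ⁻¹ * B ≈ Z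
    X-Y≈Z = x≈z+y⇒x-y≈z (*-cancelˡ (x≉0∧y≉0⇒x*y≉0 a≉0 a≉0) (begin
      a * a * (P * a ⁻¹ * h)
        ≈⟨ solve 3 (λ a u h → a :* a :* (u :* h) := a :* (a :* u :* h)) refl _ _ _ ⟩
      a * (a * (P * a ⁻¹) * h)
        ≈⟨ *-congˡ (*-congʳ (a*[x*a⁻¹]≈x P a≉0)) ⟩
      a * (P * h)
        ≈⟨ aPh≈ ⟩
      a * (x * y + z * w) + Q * B
        ≈⟨ +-cong (*-congˡ aZ≈) (*-congʳ (a*[x*a⁻¹]≈x Q (x≉0∧y≉0⇒x*y≉0 a≉0 a≉0))) ⟨
      a * (a * Z) + a * a * (Q * (a * a) ⁻¹) * B
        ≈⟨ solve 4 (λ a z u b → a :* (a :* z) :+ a :* a :* u :* b := a :* a :* (z :+ u :* b)) refl _ _ _ _ ⟩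
      a * a * (Z + Q * (a * a) ⁻¹ * B)
        ∎))

module QCalculus {c ℓ} (F : Field c ℓ) (q : Field.Carrier F) where
  open Field F
  open QDefs F q
  open FieldProperties F
  open import Algebra.Solver.Ring.NaturalCoefficients.Default commutativeSemiring
  open import Relation.Binary.Reasoning.Setoid setoid

  qint-suc : ∀ n → qint (suc n) ≈ 1# + q * qint n
  qint-suc zero    = solve 1 (λ q → con 0 :+ con 1 := con 1 :+ q :* con 0) refl q
  qint-suc (suc n) = begin
    qint (suc n) + qpow (suc n)
      ≈⟨ +-congʳ (qint-suc n) ⟩
    1# + q * qint n + q * qpow n
      ≈⟨ solve 3 (λ q a p → con 1 :+ q :* a :+ q :* p := con 1 :+ q :* (a :+ p)) refl _ _ _ ⟩
    1# + q * qint (suc n)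
      ∎

  qint-+ : ∀ m n → qint (m +ℕ n) ≈ qint m + qpow m * qint n
  qint-+ zero    n = solve 1 (λ a → a := con 0 :+ con 1 :* a) refl _
  qint-+ (suc m) n = begin
    qint (suc (m +ℕ n))
      ≈⟨ qint-suc (m +ℕ n) ⟩
    1# + q * qint (m +ℕ n)
      ≈⟨ +-congˡ (*-congˡ (qint-+ m n)) ⟩
    1# + q * (qint m + qpow m * qint n)
      ≈⟨ solve 4 (λ q a p b → con 1 :+ q :* (a :+ p :* b) := con 1 :+ q :* a :+ q :* p :* b) refl _ _ _ _ ⟩
    1# + q * qint m + q * qpow m * qint n
      ≈⟨ +-congʳ (qint-suc m) ⟨
    qint (suc m) + qpow (suc m) * qint n
      ∎

  qint-suc*qint-suc : ∀ a b → qint (suc a) * qint (suc b) ≈ qint (suc (a +ℕ b)) + q * qint a * qint b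
  qint-suc*qint-suc a b = begin
    qint (suc a) * qint (suc b)
      ≈⟨ *-congˡ (qint-suc b) ⟩
    (qint a + qpow a) * (1# + q * qint b)
      ≈⟨ solve 4 (λ q x p y → (x :+ p) :* (con 1 :+ q :* y) := x :+ p :+ q :* p :* y :+ q :* x :* y)
           refl _ _ _ _ ⟩
    qint (suc a) + qpow (suc a) * qint b + q * qint a * qint b
      ≈⟨ +-congʳ (qint-+ (suc a) b) ⟨
    qint (suc (a +ℕ b)) + q * qint a * qint b
      ∎

  qbinom-≤ : ∀ {n k} → k ≤ n → qbinom n k ≈ qfact n * (qfact k * qfact (n ∸ k)) ⁻¹
  qbinom-≤ {n} {k} k≤n with k ≤? n
  ... | yes _   = refl
  ... | no  k≰n = contradiction k≤n k≰n

  K : ℕ → ℕ → Carrier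
  K s m = qbinom (m +ℕ s) s

  qbinom≡K : ∀ {n} s m → m +ℕ s ≡ n → qbinom n s ≡ K s m
  qbinom≡K s m m+s≡n = ≡.cong (λ j → qbinom j s) (≡.sym m+s≡n)

  module Nondegenerate (q≉0 : ¬ q ≈ 0#) (N : ℕ)
                       ([k]≉0 : ∀ k → 1 ≤ k → k ≤ N → ¬ qint k ≈ 0#) where

    +-suc-≤ : ∀ m s → suc m +ℕ s ≤ N → m +ℕ suc s ≤ N
    +-suc-≤ m s = ≡.subst (_≤ N) (≡.sym (ℕₚ.+-suc m s))

    +-sucʳ-≤ : ∀ m s → m +ℕ suc s ≤ N → m +ℕ s ≤ N
    +-sucʳ-≤ m s = ℕₚ.≤-trans (ℕₚ.+-monoʳ-≤ m (ℕₚ.n≤1+n s))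

    qint≉0 : ∀ {k} → suc k ≤ N → ¬ qint (suc k) ≈ 0#
    qint≉0 = [k]≉0 _ (s≤s z≤n)

    qfact≉0 : ∀ {k} → k ≤ N → ¬ qfact k ≈ 0#
    qfact≉0 {zero}  _   1≈0 = 0≉1 (sym 1≈0)
    qfact≉0 {suc k} k<N = x≉0∧y≉0⇒x*y≉0 (qint≉0 k<N) (qfact≉0 (ℕₚ.<⇒≤ k<N))

    qfact*qfact≉0 : ∀ s m → m +ℕ s ≤ N → ¬ qfact s * qfact m ≈ 0#
    qfact*qfact≉0 s m m+s≤N =
      x≉0∧y≉0⇒x*y≉0 (qfact≉0 (ℕₚ.m+n≤o⇒n≤o m m+s≤N))
                    (qfact≉0 (ℕₚ.m+n≤o⇒m≤o m m+s≤N))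

    K-factorial : ∀ s m → m +ℕ s ≤ N → qfact s * qfact m * K s m ≈ qfact (m +ℕ s)
    K-factorial s m m+s≤N = begin
      qfact s * qfact m * K s m
        ≈⟨ *-congˡ (qbinom-≤ (ℕₚ.m≤n+m s m)) ⟩
      qfact s * qfact m * (qfact (m +ℕ s) * (qfact s * qfact (m +ℕ s ∸ s)) ⁻¹)
        ≡⟨ ≡.cong (λ j → qfact s * qfact m * (qfact (m +ℕ s) * (qfact s * qfact j) ⁻¹))
                  (ℕₚ.m+n∸n≡m m s) ⟩
      qfact s * qfact m * (qfact (m +ℕ s) * (qfact s * qfact m) ⁻¹)
        ≈⟨ a*[x*a⁻¹]≈x _ (qfact*qfact≉0 s m m+s≤N) ⟩
      qfact (m +ℕ s)
        ∎

    K-zeroˡ : ∀ m → m +ℕ 0 ≤ N → K 0 m ≈ 1#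
    K-zeroˡ m m+0≤N = *-cancelˡ (qfact*qfact≉0 0 m m+0≤N) (begin
      qfact 0 * qfact m * K 0 m  ≈⟨ K-factorial 0 m m+0≤N ⟩
      qfact (m +ℕ 0)             ≡⟨ ≡.cong qfact (ℕₚ.+-identityʳ m) ⟩
      qfact m                    ≈⟨ solve 1 (λ x → x := con 1 :* x :* con 1) refl _ ⟩
      qfact 0 * qfact m * 1#     ∎)

    K-zeroʳ : ∀ s → s ≤ N → K s 0 ≈ 1#
    K-zeroʳ s s≤N = *-cancelˡ (qfact*qfact≉0 s 0 s≤N) (begin
      qfact s * qfact 0 * K s 0  ≈⟨ K-factorial s 0 s≤N ⟩
      qfact s                    ≈⟨ solve 1 (λ x → x := x :* con 1 :* con 1) refl _ ⟩
      qfact s * qfact 0 * 1#     ∎)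

    K-absorbˡ : ∀ s m → m +ℕ suc s ≤ N → qint (suc s) * K (suc s) m ≈ qint (m +ℕ suc s) * K s m
    K-absorbˡ s m h = *-cancelˡ (qfact*qfact≉0 s m (+-sucʳ-≤ m s h)) (begin
      qfact s * qfact m * (qint (suc s) * K (suc s) m)
        ≈⟨ solve 4 (λ a b c k → a :* b :* (c :* k) := c :* a :* b :* k) refl _ _ _ _ ⟩
      qfact (suc s) * qfact m * K (suc s) m
        ≈⟨ K-factorial (suc s) m h ⟩
      qfact (m +ℕ suc s)
        ≡⟨ ≡.cong qfact (ℕₚ.+-suc m s) ⟩
      qint (suc (m +ℕ s)) * qfact (m +ℕ s)
        ≈⟨ *-cong (reflexive (≡.cong qint (ℕₚ.+-suc m s))) (K-factorial s m (+-sucʳ-≤ m s h)) ⟨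
      qint (m +ℕ suc s) * (qfact s * qfact m * K s m)
        ≈⟨ solve 4 (λ a b c k → c :* (a :* b :* k) := a :* b :* (c :* k)) refl _ _ _ _ ⟩
      qfact s * qfact m * (qint (m +ℕ suc s) * K s m)
        ∎)

    K-absorbʳ : ∀ s m → suc m +ℕ s ≤ N → qint (suc m) * K s (suc m) ≈ qint (suc m +ℕ s) * K s m
    K-absorbʳ s m h = *-cancelˡ (qfact*qfact≉0 s m (ℕₚ.<⇒≤ h)) (begin
      qfact s * qfact m * (qint (suc m) * K s (suc m))
        ≈⟨ solve 4 (λ a b c k → a :* b :* (c :* k) := a :* (c :* b) :* k) refl _ _ _ _ ⟩
      qfact s * qfact (suc m) * K s (suc m)
        ≈⟨ K-factorial s (suc m) h ⟩
      qint (suc m +ℕ s) * qfact (m +ℕ s)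
        ≈⟨ *-congˡ (K-factorial s m (ℕₚ.<⇒≤ h)) ⟨
      qint (suc m +ℕ s) * (qfact s * qfact m * K s m)
        ≈⟨ solve 4 (λ a b c k → c :* (a :* b :* k) := a :* b :* (c :* k)) refl _ _ _ _ ⟩
      qfact s * qfact m * (qint (suc m +ℕ s) * K s m)
        ∎)

    K-swap : ∀ s m → suc m +ℕ s ≤ N → qint (suc m) * K s (suc m) ≈ qint (suc s) * K (suc s) m
    K-swap s m h = begin
      qint (suc m) * K s (suc m)  ≈⟨ K-absorbʳ s m h ⟩
      qint (suc m +ℕ s) * K s m   ≡⟨ ≡.cong (λ j → qint j * K s m) (ℕₚ.+-suc m s) ⟨
      qint (m +ℕ suc s) * K s m   ≈⟨ K-absorbˡ s m (+-suc-≤ m s h) ⟨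
      qint (suc s) * K (suc s) m  ∎

    K-pascal : ∀ s m → suc m +ℕ suc s ≤ N →
      K (suc s) (suc m) ≈ K (suc s) m + qpow (suc m) * K s (suc m)
    K-pascal s m h = *-cancelˡ (qint≉0 (ℕₚ.m+n≤o⇒n≤o (suc m) h)) (begin
      qint (suc s) * K (suc s) (suc m)
        ≈⟨ K-absorbˡ s (suc m) h ⟩
      qint (suc m +ℕ suc s) * K s (suc m)
        ≈⟨ *-congʳ (qint-+ (suc m) (suc s)) ⟩
      (qint (suc m) + qpow (suc m) * qint (suc s)) * K s (suc m)
        ≈⟨ solve 4 (λ a x c k → (a :+ x :* c) :* k := a :* k :+ x :* (c :* k)) refl _ _ _ _ ⟩
      qint (suc m) * K s (suc m) + qpow (suc m) * (qint (suc s) * K s (suc m))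
        ≈⟨ +-congʳ (K-swap s m (+-sucʳ-≤ (suc m) s h)) ⟩
      qint (suc s) * K (suc s) m + qpow (suc m) * (qint (suc s) * K s (suc m))
        ≈⟨ solve 4 (λ c k x k′ → c :* k :+ x :* (c :* k′) := c :* (k :+ x :* k′)) refl _ _ _ _ ⟩
      qint (suc s) * (K (suc s) m + qpow (suc m) * K s (suc m))
        ∎)

    K-three-term : ∀ s m → suc m +ℕ suc s ≤ N →
      qint (suc (suc s)) * qint (suc m) * K (suc s) m
        ≈ qint (suc (suc s)) * K (suc (suc s)) m + q * qint m * (qint (suc m) * K s (suc m))
    K-three-term s m h = begin
      qint (suc (suc s)) * qint (suc m) * K (suc s) m
        ≈⟨ *-congʳ (*-comm _ _) ⟩
      qint (suc m) * qint (suc (suc s)) * K (suc s) m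
        ≈⟨ *-congʳ (qint-suc*qint-suc m (suc s)) ⟩
      (qint (suc m +ℕ suc s) + q * qint m * qint (suc s)) * K (suc s) m
        ≈⟨ solve 5 (λ n q a c k → (n :+ q :* a :* c) :* k := n :* k :+ q :* a :* (c :* k)) refl _ _ _ _ _ ⟩
      qint (suc m +ℕ suc s) * K (suc s) m + q * qint m * (qint (suc s) * K (suc s) m)
        ≡⟨ ≡.cong (λ j → qint j * K (suc s) m + q * qint m * (qint (suc s) * K (suc s) m))
                  (ℕₚ.+-suc m (suc s)) ⟨
      qint (m +ℕ suc (suc s)) * K (suc s) m + q * qint m * (qint (suc s) * K (suc s) m)
        ≈⟨ +-cong (K-absorbˡ (suc s) m (+-suc-≤ m (suc s) h))
                  (*-congˡ (K-swap s m (+-sucʳ-≤ (suc m) s h))) ⟨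
      qint (suc (suc s)) * K (suc (suc s)) m + q * qint m * (qint (suc m) * K s (suc m))
        ∎

    H-at-one : ∀ s → H (suc s) 1 ≈ qpow s
    H-at-one zero = begin
      0# + q * 1# * (q * qint 1) ⁻¹
        ≈⟨ solve 2 (λ q u → con 0 :+ q :* con 1 :* u := q :* (con 0 :+ con 1) :* u) refl _ _ ⟩
      q * qint 1 * (q * qint 1) ⁻¹
        ≈⟨ inverseʳ _ (x≉0∧y≉0⇒x*y≉0 q≉0 [1]≉0) ⟩
      1#
        ∎
      where
      [1]≉0 : ¬ qint 1 ≈ 0#
      [1]≉0 [1]≈0 = 0≉1 (trans (sym [1]≈0) (+-identityˡ 1#))
    H-at-one (suc s) = begin
      0# + q * 1# * H (suc s) 1  ≈⟨ solve 2 (λ q h → con 0 :+ q :* con 1 :* h := q :* h) refl _ _ ⟩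
      q * H (suc s) 1            ≈⟨ *-congˡ (H-at-one s) ⟩
      q * qpow s                 ∎

    H-recurrence : ∀ s m → suc m +ℕ s ≤ N →
      q * qint (suc m) * H s (suc m) ≈ q * qint s * H (suc s) m + qpow s * K s m
    H-recurrence zero m h = begin
      q * qint (suc m) * H 0 (suc m)
        ≈⟨ inverseʳ _ (x≉0∧y≉0⇒x*y≉0 q≉0 (qint≉0 (ℕₚ.m+n≤o⇒m≤o (suc m) h))) ⟩
      1#
        ≈⟨ K-zeroˡ m (ℕₚ.<⇒≤ h) ⟨
      K 0 m
        ≈⟨ solve 3 (λ q h k → k := q :* con 0 :* h :+ con 1 :* k) refl _ _ _ ⟩
      q * qint 0 * H 1 m + qpow 0 * K 0 m
        ∎
    H-recurrence (suc s) zero h = begin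
      q * qint 1 * H (suc s) 1
        ≈⟨ solve 2 (λ q h → q :* (con 0 :+ con 1) :* h := q :* h) refl _ _ ⟩
      q * H (suc s) 1
        ≈⟨ *-congˡ (H-at-one s) ⟩
      q * qpow s
        ≈⟨ *-identityʳ _ ⟨
      q * qpow s * 1#
        ≈⟨ *-congˡ (K-zeroʳ (suc s) (ℕₚ.<⇒≤ h)) ⟨
      q * qpow s * K (suc s) 0
        ≈⟨ solve 4 (λ q c y k → q :* y :* k := q :* c :* con 0 :+ q :* y :* k) refl _ _ _ _ ⟩
      q * qint (suc s) * H (suc (suc s)) 0 + qpow (suc s) * K (suc s) 0
        ∎
    H-recurrence (suc s) (suc m) h = begin
      q * qint (suc (suc m)) * H (suc s) (suc (suc m))
        ≈⟨ solve 5 (λ q a x h₁ h₀ → q :* (a :+ x) :* (h₁ :+ q :* x :* h₀)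
                                   := q :* a :* h₁ :+ q :* x :* (q :* (a :+ x) :* h₀) :+ q :* x :* h₁)
             refl _ _ _ _ _ ⟩
      q * qint (suc m) * H (suc s) (suc m)
        + q * qpow (suc m) * (q * qint (suc (suc m)) * H s (suc (suc m)))
        + q * qpow (suc m) * H (suc s) (suc m)
        ≈⟨ +-congʳ (+-cong (H-recurrence (suc s) m (ℕₚ.<⇒≤ h))
                           (*-congˡ (H-recurrence s (suc m) (+-sucʳ-≤ (suc (suc m)) s h)))) ⟩
      q * qint (suc s) * H (suc (suc s)) m + qpow (suc s) * K (suc s) m
        + q * qpow (suc m) * (q * qint s * H (suc s) (suc m) + qpow s * K s (suc m))
        + q * qpow (suc m) * H (suc s) (suc m)
        ≈⟨ solve 9 (λ q c g y k₁ x b h₁ k₀ →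
                      q :* c :* g :+ q :* y :* k₁ :+ q :* x :* (q :* b :* h₁ :+ y :* k₀) :+ q :* x :* h₁
                      := q :* c :* g :+ q :* x :* (con 1 :+ q :* b) :* h₁ :+ q :* y :* (k₁ :+ x :* k₀))
             refl _ _ _ _ _ _ _ _ _ ⟩
      q * qint (suc s) * H (suc (suc s)) m
        + q * qpow (suc m) * (1# + q * qint s) * H (suc s) (suc m)
        + q * qpow s * (K (suc s) m + qpow (suc m) * K s (suc m))
        ≈⟨ +-cong (+-congˡ (*-congʳ (*-congˡ (qint-suc s)))) (*-congˡ (K-pascal s m (ℕₚ.<⇒≤ h))) ⟨
      q * qint (suc s) * H (suc (suc s)) m
        + q * qpow (suc m) * qint (suc s) * H (suc s) (suc m)
        + q * qpow s * K (suc s) (suc m)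
        ≈⟨ solve 7 (λ q c g x h₁ y k → q :* c :* g :+ q :* x :* c :* h₁ :+ q :* y :* k
                                      := q :* c :* (g :+ x :* h₁) :+ q :* y :* k)
             refl _ _ _ _ _ _ _ ⟩
      q * qint (suc s) * H (suc (suc s)) (suc m) + qpow (suc s) * K (suc s) (suc m)
        ∎

    H-recurrence′ : ∀ s m → suc m +ℕ suc s ≤ N →
      qint (suc m) * H (suc s) (suc m) ≈ qint (suc s) * H (suc (suc s)) m + qpow s * K (suc s) m
    H-recurrence′ s m h = *-cancelˡ q≉0 (begin
      q * (qint (suc m) * H (suc s) (suc m))
        ≈⟨ *-assoc _ _ _ ⟨
      q * qint (suc m) * H (suc s) (suc m)
        ≈⟨ H-recurrence (suc s) m h ⟩
      q * qint (suc s) * H (suc (suc s)) m + qpow (suc s) * K (suc s) m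
        ≈⟨ solve 5 (λ q c g y k → q :* c :* g :+ q :* y :* k := q :* (c :* g :+ y :* k)) refl _ _ _ _ _ ⟩
      q * (qint (suc s) * H (suc (suc s)) m + qpow s * K (suc s) m)
        ∎)

    H-raise-order : ∀ s m → suc m +ℕ suc s ≤ N →
      qint (suc s) * H (suc (suc s)) (suc m) + qpow s * K (suc s) m
        ≈ qint (suc m +ℕ suc s) * H (suc s) (suc m)
    H-raise-order s m h = begin
      qint (suc s) * H (suc (suc s)) (suc m) + qpow s * K (suc s) m
        ≈⟨ solve 6 (λ c g x h₁ y k → c :* (g :+ x :* h₁) :+ y :* k := c :* g :+ y :* k :+ x :* c :* h₁)
             refl _ _ _ _ _ _ ⟩
      qint (suc s) * H (suc (suc s)) m + qpow s * K (suc s) m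
        + qpow (suc m) * qint (suc s) * H (suc s) (suc m)
        ≈⟨ +-congʳ (H-recurrence′ s m h) ⟨
      qint (suc m) * H (suc s) (suc m) + qpow (suc m) * qint (suc s) * H (suc s) (suc m)
        ≈⟨ solve 4 (λ a x c h₁ → a :* h₁ :+ x :* c :* h₁ := (a :+ x :* c) :* h₁) refl _ _ _ _ ⟩
      (qint (suc m) + qpow (suc m) * qint (suc s)) * H (suc s) (suc m)
        ≈⟨ *-congʳ (qint-+ (suc m) (suc s)) ⟨
      qint (suc m +ℕ suc s) * H (suc s) (suc m)
        ∎

    weighted-H-sum : ∀ s m → suc m +ℕ suc s ≤ N →
      qint (suc (suc s)) * Σ₁ (suc m) (λ l → qpow (l ∸ 1) * qint l * H (suc s) l)
        ≈ qint (suc m) * qint (suc s) * H (suc (suc s)) (suc m) + qpow s * K (suc (suc s)) m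
    weighted-H-sum s zero h = begin
      qint (suc (suc s)) * (0# + 1# * qint 1 * H (suc s) 1)
        ≈⟨ *-cong (qint-suc (suc s)) (solve 1 (λ h → con 0 :+ con 1 :* (con 0 :+ con 1) :* h := h) refl _) ⟩
      (1# + q * qint (suc s)) * H (suc s) 1
        ≈⟨ *-congˡ (H-at-one s) ⟩
      (1# + q * qint (suc s)) * qpow s
        ≈⟨ solve 3 (λ q c y → (con 1 :+ q :* c) :* y
                             := (con 0 :+ con 1) :* c :* (con 0 :+ q :* con 1 :* y) :+ y :* con 1)
             refl _ _ _ ⟩
      qint 1 * qint (suc s) * (0# + q * 1# * qpow s) + qpow s * 1#
        ≈⟨ +-cong (*-congˡ (+-congˡ (*-congˡ (H-at-one s)))) (*-congˡ (K-zeroʳ (suc (suc s)) h)) ⟨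
      qint 1 * qint (suc s) * H (suc (suc s)) 1 + qpow s * K (suc (suc s)) 0
        ∎
    weighted-H-sum s (suc m) h = begin
      qint (suc (suc s)) * (Σ₁ (suc m) f + qpow (suc m) * qint (suc (suc m)) * H (suc s) (suc (suc m)))
        ≈⟨ solve 5 (λ a σ x b h₂ → a :* (σ :+ x :* b :* h₂) := a :* σ :+ x :* (a :* (b :* h₂)))
             refl _ _ _ _ _ ⟩
      qint (suc (suc s)) * Σ₁ (suc m) f
        + qpow (suc m) * (qint (suc (suc s)) * (qint (suc (suc m)) * H (suc s) (suc (suc m))))
        ≈⟨ +-cong (weighted-H-sum s m (ℕₚ.<⇒≤ h)) (*-congˡ (*-congʳ (qint-suc (suc s)))) ⟩
      qint (suc m) * qint (suc s) * H (suc (suc s)) (suc m) + qpow s * K (suc (suc s)) m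
        + qpow (suc m) * ((1# + q * qint (suc s)) * (qint (suc (suc m)) * H (suc s) (suc (suc m))))
        ≈⟨ solve 8 (λ a c g y k₂ x q h₂ →
                      a :* c :* g :+ y :* k₂ :+ x :* ((con 1 :+ q :* c) :* ((a :+ x) :* h₂))
                      := a :* c :* g :+ y :* k₂ :+ x :* ((a :+ x) :* h₂) :+ q :* c :* x :* ((a :+ x) :* h₂))
             refl _ _ _ _ _ _ _ _ ⟩
      qint (suc m) * qint (suc s) * H (suc (suc s)) (suc m) + qpow s * K (suc (suc s)) m
        + qpow (suc m) * (qint (suc (suc m)) * H (suc s) (suc (suc m)))
        + q * qint (suc s) * qpow (suc m) * (qint (suc (suc m)) * H (suc s) (suc (suc m)))
        ≈⟨ +-congʳ (+-congˡ (*-congˡ (H-recurrence′ s (suc m) h))) ⟩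
      qint (suc m) * qint (suc s) * H (suc (suc s)) (suc m) + qpow s * K (suc (suc s)) m
        + qpow (suc m) * (qint (suc s) * H (suc (suc s)) (suc m) + qpow s * K (suc s) (suc m))
        + q * qint (suc s) * qpow (suc m) * (qint (suc (suc m)) * H (suc s) (suc (suc m)))
        ≈⟨ solve 9 (λ a c g y k₂ x k₁ q h₂ →
                      a :* c :* g :+ y :* k₂ :+ x :* (c :* g :+ y :* k₁) :+ q :* c :* x :* ((a :+ x) :* h₂)
                      := (a :+ x) :* c :* (g :+ q :* x :* h₂) :+ y :* (k₂ :+ x :* k₁))
             refl _ _ _ _ _ _ _ _ _ ⟩
      qint (suc (suc m)) * qint (suc s) * H (suc (suc s)) (suc (suc m))
        + qpow s * (K (suc (suc s)) m + qpow (suc m) * K (suc s) (suc m))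
        ≈⟨ +-congˡ (*-congˡ (K-pascal (suc s) m (+-suc-≤ (suc m) (suc s) h))) ⟨
      qint (suc (suc m)) * qint (suc s) * H (suc (suc s)) (suc (suc m)) + qpow s * K (suc (suc s)) (suc m)
        ∎
      where
      f : ℕ → Carrier
      f l = qpow (l ∸ 1) * qint l * H (suc s) l

    H-expansion : ∀ s m → suc m +ℕ suc s ≤ N →
      qint (suc (suc s)) * (qint (suc m) * qint (suc m +ℕ suc s) * H (suc s) (suc m))
        ≈ qint (suc (suc s)) * (qint (suc m) * qint (suc s) * H (suc (suc s)) (suc m)
                                + qpow s * K (suc (suc s)) m)
          + qpow (suc s) * qint m * qint (suc m) * K s (suc m)
    H-expansion s m h = begin
      qint (suc (suc s)) * (qint (suc m) * qint (suc m +ℕ suc s) * H (suc s) (suc m))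
        ≈⟨ solve 4 (λ a b n h₁ → a :* (b :* n :* h₁) := a :* b :* (n :* h₁)) refl _ _ _ _ ⟩
      qint (suc (suc s)) * qint (suc m) * (qint (suc m +ℕ suc s) * H (suc s) (suc m))
        ≈⟨ *-congˡ (H-raise-order s m h) ⟨
      qint (suc (suc s)) * qint (suc m) * (qint (suc s) * H (suc (suc s)) (suc m) + qpow s * K (suc s) m)
        ≈⟨ solve 6 (λ a b c g y k → a :* b :* (c :* g :+ y :* k) := a :* (b :* c :* g) :+ y :* (a :* b :* k))
             refl _ _ _ _ _ _ ⟩
      qint (suc (suc s)) * (qint (suc m) * qint (suc s) * H (suc (suc s)) (suc m))
        + qpow s * (qint (suc (suc s)) * qint (suc m) * K (suc s) m)
        ≈⟨ +-congˡ (*-congˡ (K-three-term s m h)) ⟩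
      qint (suc (suc s)) * (qint (suc m) * qint (suc s) * H (suc (suc s)) (suc m))
        + qpow s * (qint (suc (suc s)) * K (suc (suc s)) m + q * qint m * (qint (suc m) * K s (suc m)))
        ≈⟨ solve 9 (λ a b c g y k₂ q d k₀ → a :* (b :* c :* g) :+ y :* (a :* k₂ :+ q :* d :* (b :* k₀))
                                           := a :* (b :* c :* g :+ y :* k₂) :+ q :* y :* d :* b :* k₀)
             refl _ _ _ _ _ _ _ _ _ ⟩
      qint (suc (suc s)) * (qint (suc m) * qint (suc s) * H (suc (suc s)) (suc m)
                            + qpow s * K (suc (suc s)) m)
        + qpow (suc s) * qint m * qint (suc m) * K s (suc m)
        ∎

theorem2 : ∀ {c ℓ} (F : Field c ℓ) (q : Field.Carrier F) (n r : ℕ) →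
    1 ≤ n → 1 ≤ r →
    let open Field F
        open QDefs F q
    in ¬ (q ≈ 0#) →
       (∀ k → 1 ≤ k → k ≤ n +ℕ r → ¬ (qint k ≈ 0#)) →
       (Σ₁ n (λ l → qpow (l ∸ 1) * qint l * H r l)
          ≈ qint n * qint (n +ℕ r) / qint (r +ℕ 1) * H r n
            - qpow r * qint (n ∸ 1) * qint n / (qint (r +ℕ 1) * qint (r +ℕ 1))
              * qbinom (n +ℕ r ∸ 1) (r ∸ 1))
       × (qint n * qint (n +ℕ r) / qint (r +ℕ 1) * H r n
            - qpow r * qint (n ∸ 1) * qint n / (qint (r +ℕ 1) * qint (r +ℕ 1))
              * qbinom (n +ℕ r ∸ 1) (r ∸ 1)
          ≈ qint n * qint r / qint (r +ℕ 1) * H (r +ℕ 1) n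
            + qpow (r ∸ 1) / qint (r +ℕ 1) * qbinom (n +ℕ r) (r +ℕ 1))
theorem2 F q (suc m) (suc s) (s≤s z≤n) (s≤s z≤n) q≉0 [k]≉0
  rewrite ℕₚ.+-comm s 1
        | QCalculus.qbinom≡K F q (suc (suc s)) m (ℕₚ.+-suc m (suc s))
        | QCalculus.qbinom≡K F q s (suc m) (≡.sym (ℕₚ.+-suc m s))
  = clear-denominators [s+2]≉0 (weighted-H-sum s m ℕₚ.≤-refl) (H-expansion s m ℕₚ.≤-refl)
  where
  open Field F
  open QDefs F q
  open FieldProperties F
  open QCalculus F q
  open Nondegenerate q≉0 (suc m +ℕ suc s) [k]≉0

  [s+2]≉0 : ¬ qint (suc (suc s)) ≈ 0#
  [s+2]≉0 = qint≉0 (s≤s (ℕₚ.m≤n+m (suc s) m))
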